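{- Let $p$ be an odd prime, $N\ge1$ an integer and $\mathcal V=\mathcal V(p,N)$. Then \[ \frac1{\#\mathcal V^2}\sum_{\alpha\in\mathcal V}\sum_{\beta\in\mathcal V}\mathfrak d_{p,N}(\alpha,\beta)^4=\frac1{4(p-1)}\big(p-2+p^{ -1}+2p^{ -2}-5p^{ -3}-4p^{ -4}\big). \]
   Context: $\omega=\exp(2\pi i/p)$; $\mathcal V(p,N)=\{\sum_{j=1}^{p-1}a_j\omega^j: a_j\in\{ -N,N\}\}$. For $\gamma\in\mathbb{Q}(\omega)$, $\mathrm{Tr}(\gamma)=\sum_{\sigma\in\mathrm{Gal}(\mathbb{Q}(\omega)/\mathbb{Q})}\sigma(\gamma)$, $\|\gamma\|=\big(\sum_{j=1}^{p-1}\mathrm{Tr}(\gamma\omega^j)^2\big)^{1/2}$, $\mathfrak d_{p,N}(\alpha,\beta)=\|\beta-\alpha\|/(2Np(p-1)^{1/2})$. -}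

module Defs where

open import Data.Nat as ℕ using (ℕ; zero; suc; _∸_; _%_; NonZero)
open import Data.Bool using (Bool; true; false; if_then_else_)
open import Data.List using (List; []; _∷_; map; upTo; foldr; length; concatMap; filterᵇ)
open import Data.Integer using (ℤ; +_)
open import Data.Rational using (ℚ; 0ℚ; 1ℚ; _+_; _*_; _-_; -_)
import Data.Rational as ℚ
open import Relation.Nullary.Decidable using (does)

Σℚ : List ℚ → ℚ
Σℚ = foldr _+_ 0ℚ

ℕ→ℚ : ℕ → ℚ
ℕ→ℚ n = (+ n) ℚ./ 1

-- q / n  (division by a natural number; the value at n = 0 is never used)
_/ℕ_ : ℚ → ℕ → ℚ
q /ℕ zero  = 0ℚ
q /ℕ suc n = q * ((+ 1) ℚ./ suc n)

_^ℚ_ : ℚ → ℕ → ℚ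
q ^ℚ zero  = 1ℚ
q ^ℚ suc k = q * (q ^ℚ k)

-- The cyclotomic field ℚ(ω), ω = exp(2πi/p).
-- An element is represented by a coefficient function e : ℕ → ℚ, standing
-- for  Σ_{m=0}^{p-1} e m · ω^m  (only the values at m < p matter).
-- (This spanning representation is not unique, but every operation below
-- is well defined on ℚ(ω), and the trace is read off as a rational.)

Elt : Set
Elt = ℕ → ℚ

module Cyclo (p : ℕ) .{{_ : NonZero p}} where

  idx : List ℕ
  idx = upTo p

  sub : Elt → Elt → Elt
  sub γ δ m = γ m - δ m

  -- γ · ω^j : coefficient at n is γ((n - j) mod p)
  mulω : ℕ → Elt → Elt
  mulω j γ n = γ ((n ℕ.+ (p ∸ (j % p))) % p)

  -- Galois automorphism σ_k : ω ↦ ω^k  (k = 1, …, p-1):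
  -- σ_k(Σ e_m ω^m) = Σ e_m ω^{mk}; coefficient at n collects all m with mk ≡ n
  σ : ℕ → Elt → Elt
  σ k γ n = Σℚ (map γ (filterᵇ (λ m → does (((m ℕ.* k) % p) ℕ.≟ n)) idx))

  TrElt : Elt → Elt
  TrElt γ n = Σℚ (map (λ k → σ k γ n) (map suc (upTo (p ∸ 1))))

  -- The value of a rational element Σ_{m<p} e_m ω^m in ℚ(ω) whose
  -- coefficients e_1 = … = e_{p-1} agree (as is the case for TrElt γ):
  -- since 1 + ω + … + ω^{p-1} = 0 it equals e_0 - e_1.
  Tr : Elt → ℚ
  Tr γ = TrElt γ 0 - TrElt γ 1

  norm² : Elt → ℚ
  norm² γ = Σℚ (map (λ j → Tr (mulω j γ) * Tr (mulω j γ)) (map suc (upTo (p ∸ 1))))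

  -- 𝔡_{p,N}(α,β)^4 = ‖β-α‖^4 / (2 N p (p-1)^{1/2})^4
  --               = (‖β-α‖²)² / ((2Np)^4 (p-1)^2)
  𝔡⁴ : ℕ → Elt → Elt → ℚ
  𝔡⁴ N α β = (norm² (sub β α) * norm² (sub β α))
               /ℕ (((2 ℕ.* N ℕ.* p) ℕ.^ 4) ℕ.* ((p ∸ 1) ℕ.^ 2))

-- The set 𝒱(p,N) = { Σ_{j=1}^{p-1} a_j ω^j : a_j ∈ {-N, N} }.
-- It is enumerated by sign lists s of length p-1 (true ↦ +N, false ↦ -N);
-- distinct sign lists give distinct elements since ω, …, ω^{p-1} is a
-- ℚ-basis of ℚ(ω).

allSigns : ℕ → List (List Bool)
allSigns zero    = [] ∷ []
allSigns (suc n) = concatMap (λ s → (true ∷ s) ∷ (false ∷ s) ∷ []) (allSigns n)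

signCoeff : ℕ → List Bool → ℕ → ℚ
signCoeff N []          i       = 0ℚ
signCoeff N (b ∷ s)     zero    = if b then ℕ→ℚ N else - ℕ→ℚ N
signCoeff N (b ∷ s)     (suc i) = signCoeff N s i

-- the element Σ_{j=1}^{p-1} a_j ω^j with a_{j} given by entry j-1 of s
toElt : ℕ → List Bool → Elt
toElt N s zero    = 0ℚ
toElt N s (suc i) = signCoeff N s i

𝒱 : ℕ → ℕ → List Elt
𝒱 p N = map (toElt N) (allSigns (p ∸ 1))

average𝔡⁴ : (p : ℕ) .{{_ : NonZero p}} → ℕ → ℚ
average𝔡⁴ p N =
  Σℚ (map (λ α → Σℚ (map (λ β → Cyclo.𝔡⁴ p N α β) (𝒱 p N))) (𝒱 p N))
    /ℕ (length (𝒱 p N) ℕ.* length (𝒱 p N))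

rhs : ℕ → ℚ
rhs p = (ℕ→ℚ p - ℕ→ℚ 2 + (1ℚ /ℕ p) + (ℕ→ℚ 2 /ℕ (p ℕ.^ 2))
          - (ℕ→ℚ 5 /ℕ (p ℕ.^ 3)) - (ℕ→ℚ 4 /ℕ (p ℕ.^ 4)))
        /ℕ (4 ℕ.* (p ∸ 1))

{-# OPTIONS --safe #-}
module Submission where

-- Write β − α = Σⱼ xⱼ ωʲ (j = 1 … p−1). Since p is prime, each σₖ permutes ω, …, ω^(p−1), so
-- Tr(Σₘ eₘ ωᵐ) = p e₀ − Σₘ eₘ; hence Tr((β − α) ωʲ) = p x_(p−j) − D and ‖β − α‖² = p² Q − (p + 1) D²
-- with Q = Σ xⱼ² and D = Σ xⱼ. Over the four sign choices of one coordinate, xⱼ takes the values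
-- 0, 0, 2N, −2N, and adding a coordinate maps quartics in (Q, D) to quartics in (Q, D). The averages
-- of Q², Q D² and D⁴ over all pairs therefore follow by induction on the number of coordinates, and
-- the average of ‖β − α‖⁴ is a rational function of p that clears to the stated right-hand side.

open import Level using (0ℓ)
open import Algebra.Bundles using (CommutativeMonoid)
open import Data.Bool using (Bool; true; false; if_then_else_)
import Data.Integer as ℤ
import Data.Integer.Properties as ℤ
open import Data.List using (List; []; _∷_; map; upTo; applyUpTo; length; concatMap; filterᵇ)
open import Data.List.Properties using (map-∘; map-cong; map-applyUpTo; length-map)
open import Data.Nat as ℕ using (ℕ; zero; suc; _∸_; _%_; _<_; _≥_; NonZero)
import Data.Nat.Properties as ℕ
open import Data.Nat.DivMod
open import Data.Nat.Divisibility using (_∣_; divides; ∣⇒≤; m%n≡0⇒n∣m)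
open import Data.Nat.Primality using (Prime; euclidsLemma; prime⇒nonTrivial)
open import Data.Nat.Coprimality using (prime⇒coprime; coprime-Bézout)
open import Data.Nat.GCD using (module Bézout)
import Data.Nat.Tactic.RingSolver as ℕ-Solver
open import Data.Product using (∃-syntax; _×_; _,_)
open import Data.Sum using (inj₁; inj₂)
open import Data.Rational as ℚ using (ℚ; 0ℚ; 1ℚ; _+_; _*_; _-_; -_; toℚᵘ)
import Data.Rational.Properties as ℚ
import Data.Rational.Unnormalised as ℚᵘ
import Data.Rational.Unnormalised.Properties as ℚᵘ
open import Function using (_∘_; id)
open import Relation.Nullary using (does; contradiction)
open import Relation.Nullary.Decidable using (dec-true; dec-false)
open import Relation.Nullary.Decidable.Core using (dec⇒maybe)
open import Relation.Binary.PropositionalEquality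
open import Tactic.RingSolver using (solve-∀)
open import Tactic.RingSolver.Core.AlmostCommutativeRing using (AlmostCommutativeRing; fromCommutativeRing)

open import Defs
open import Algebra.Properties.CommutativeSemigroup
  (CommutativeMonoid.commutativeSemigroup ℚ.+-0-commutativeMonoid)
  using () renaming (interchange to +-interchange)

private variable
  A B : Set

-- Rationals and the embedding of ℕ

ℚ-ring : AlmostCommutativeRing 0ℓ 0ℓ
ℚ-ring = fromCommutativeRing ℚ.+-*-commutativeRing λ x → dec⇒maybe (0ℚ ℚ.≟ x)

toℚᵘ-ℕ→ℚ : ∀ n → toℚᵘ (ℕ→ℚ n) ℚᵘ.≃ ℚᵘ.mkℚᵘ (ℤ.+ n) 0
toℚᵘ-ℕ→ℚ n = ℚ.toℚᵘ-fromℚᵘ (ℚᵘ.mkℚᵘ (ℤ.+ n) 0)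

ℕ→ℚ-+ : ∀ m n → ℕ→ℚ (m ℕ.+ n) ≡ ℕ→ℚ m + ℕ→ℚ n
ℕ→ℚ-+ m n = ℚ.toℚᵘ-injective (begin
  toℚᵘ (ℕ→ℚ (m ℕ.+ n))                      ≈⟨ toℚᵘ-ℕ→ℚ (m ℕ.+ n) ⟩
  ℚᵘ.mkℚᵘ (ℤ.+ (m ℕ.+ n)) 0                  ≈⟨ ℚᵘ.*≡* (cong (ℤ._* ℤ.+ 1) +[m+n]≡+m*1++n*1) ⟩
  ℚᵘ.mkℚᵘ (ℤ.+ m) 0 ℚᵘ.+ ℚᵘ.mkℚᵘ (ℤ.+ n) 0  ≈⟨ ℚᵘ.+-cong (toℚᵘ-ℕ→ℚ m) (toℚᵘ-ℕ→ℚ n) ⟨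
  toℚᵘ (ℕ→ℚ m) ℚᵘ.+ toℚᵘ (ℕ→ℚ n)            ≈⟨ ℚ.toℚᵘ-homo-+ (ℕ→ℚ m) (ℕ→ℚ n) ⟨
  toℚᵘ (ℕ→ℚ m + ℕ→ℚ n)                      ∎)
  where
  open ℚᵘ.≃-Reasoning
  +[m+n]≡+m*1++n*1 : ℤ.+ (m ℕ.+ n) ≡ ℤ.+ m ℤ.* ℤ.+ 1 ℤ.+ ℤ.+ n ℤ.* ℤ.+ 1
  +[m+n]≡+m*1++n*1 = trans (ℤ.pos-+ m n) (sym (cong₂ ℤ._+_ (ℤ.*-identityʳ (ℤ.+ m)) (ℤ.*-identityʳ (ℤ.+ n))))

ℕ→ℚ-suc : ∀ n → ℕ→ℚ (suc n) ≡ 1ℚ + ℕ→ℚ n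
ℕ→ℚ-suc = ℕ→ℚ-+ 1

ℕ→ℚ-pred : ∀ n → ℕ→ℚ n ≡ ℕ→ℚ (suc n) - 1ℚ
ℕ→ℚ-pred n = trans (m≡[1+m]-1 (ℕ→ℚ n)) (cong (_- 1ℚ) (sym (ℕ→ℚ-suc n)))
  where
  m≡[1+m]-1 : ∀ m → m ≡ (1ℚ + m) - 1ℚ
  m≡[1+m]-1 = solve-∀ ℚ-ring

ℕ→ℚ-* : ∀ m n → ℕ→ℚ (m ℕ.* n) ≡ ℕ→ℚ m * ℕ→ℚ n
ℕ→ℚ-* m n = ℚ.toℚᵘ-injective (begin
  toℚᵘ (ℕ→ℚ (m ℕ.* n))                      ≈⟨ toℚᵘ-ℕ→ℚ (m ℕ.* n) ⟩
  ℚᵘ.mkℚᵘ (ℤ.+ (m ℕ.* n)) 0                  ≈⟨ ℚᵘ.*≡* (cong (ℤ._* ℤ.+ 1) (ℤ.pos-* m n)) ⟩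
  ℚᵘ.mkℚᵘ (ℤ.+ m) 0 ℚᵘ.* ℚᵘ.mkℚᵘ (ℤ.+ n) 0  ≈⟨ ℚᵘ.*-cong (toℚᵘ-ℕ→ℚ m) (toℚᵘ-ℕ→ℚ n) ⟨
  toℚᵘ (ℕ→ℚ m) ℚᵘ.* toℚᵘ (ℕ→ℚ n)            ≈⟨ ℚ.toℚᵘ-homo-* (ℕ→ℚ m) (ℕ→ℚ n) ⟨
  toℚᵘ (ℕ→ℚ m * ℕ→ℚ n)                      ∎)
  where open ℚᵘ.≃-Reasoning

ℕ→ℚ-^ : ∀ m k → ℕ→ℚ (m ℕ.^ k) ≡ ℕ→ℚ m ^ℚ k
ℕ→ℚ-^ m zero    = refl
ℕ→ℚ-^ m (suc k) = trans (ℕ→ℚ-* m (m ℕ.^ k)) (cong (ℕ→ℚ m *_) (ℕ→ℚ-^ m k))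

1/[1+m]*[1+m]≡1 : ∀ m → (ℤ.+ 1 ℚ./ suc m) * ℕ→ℚ (suc m) ≡ 1ℚ
1/[1+m]*[1+m]≡1 m = ℚ.toℚᵘ-injective (ℚᵘ.≃-trans (ℚ.toℚᵘ-homo-* (ℤ.+ 1 ℚ./ suc m) (ℕ→ℚ (suc m)))
  (ℚᵘ.≃-trans (ℚᵘ.*-cong (ℚ.toℚᵘ-fromℚᵘ (ℚᵘ.mkℚᵘ (ℤ.+ 1) m)) (toℚᵘ-ℕ→ℚ (suc m)))
              (ℚᵘ.*-inverseˡ (ℚᵘ.mkℚᵘ (ℤ.+ suc m) 0))))

/ℕ-*-ℕ→ℚ : ∀ q m .{{_ : NonZero m}} → (q /ℕ m) * ℕ→ℚ m ≡ q
/ℕ-*-ℕ→ℚ q (suc m) = begin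
  q * (ℤ.+ 1 ℚ./ suc m) * ℕ→ℚ (suc m)    ≡⟨ ℚ.*-assoc q _ _ ⟩
  q * ((ℤ.+ 1 ℚ./ suc m) * ℕ→ℚ (suc m))  ≡⟨ cong (q *_) (1/[1+m]*[1+m]≡1 m) ⟩
  q * 1ℚ                                 ≡⟨ ℚ.*-identityʳ q ⟩
  q                                      ∎
  where open ≡-Reasoning

/ℕ-unique : ∀ {q r} m .{{_ : NonZero m}} → q ≡ r * ℕ→ℚ m → q /ℕ m ≡ r
/ℕ-unique {q} {r} (suc m) q≡r*m = begin
  q /ℕ suc m                             ≡⟨ cong (_/ℕ suc m) q≡r*m ⟩
  r * ℕ→ℚ (suc m) * (ℤ.+ 1 ℚ./ suc m)    ≡⟨ ℚ.*-assoc r _ _ ⟩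
  r * (ℕ→ℚ (suc m) * (ℤ.+ 1 ℚ./ suc m))  ≡⟨ cong (r *_) (trans (ℚ.*-comm (ℕ→ℚ (suc m)) _) (1/[1+m]*[1+m]≡1 m)) ⟩
  r * 1ℚ                                 ≡⟨ ℚ.*-identityʳ r ⟩
  r                                      ∎
  where open ≡-Reasoning

-- Finite sums

Σℚ-map-+ : ∀ (f g : A → ℚ) xs → Σℚ (map (λ x → f x + g x) xs) ≡ Σℚ (map f xs) + Σℚ (map g xs)
Σℚ-map-+ f g []       = refl
Σℚ-map-+ f g (x ∷ xs) =
  trans (cong ((f x + g x) +_) (Σℚ-map-+ f g xs)) (+-interchange (f x) (g x) _ _)

Σℚ-map-*ʳ : ∀ c (f : A → ℚ) xs → Σℚ (map (λ x → f x * c) xs) ≡ Σℚ (map f xs) * c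
Σℚ-map-*ʳ c f []       = sym (ℚ.*-zeroˡ c)
Σℚ-map-*ʳ c f (x ∷ xs) =
  trans (cong (f x * c +_) (Σℚ-map-*ʳ c f xs)) (sym (ℚ.*-distribʳ-+ c (f x) _))

Σℚ-map-filterᵇ : ∀ (P : A → Bool) (f : A → ℚ) xs →
                 Σℚ (map f (filterᵇ P xs)) ≡ Σℚ (map (λ x → if P x then f x else 0ℚ) xs)
Σℚ-map-filterᵇ P f []       = refl
Σℚ-map-filterᵇ P f (x ∷ xs) with P x
... | true  = cong (f x +_) (Σℚ-map-filterᵇ P f xs)
... | false = trans (Σℚ-map-filterᵇ P f xs) (sym (ℚ.+-identityˡ _))

Σℚ-map-concatMap : ∀ (g h : A → B) (f : B → ℚ) xs →
                   Σℚ (map f (concatMap (λ x → g x ∷ h x ∷ []) xs)) ≡ Σℚ (map (λ x → f (g x) + f (h x)) xs)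
Σℚ-map-concatMap g h f []       = refl
Σℚ-map-concatMap g h f (x ∷ xs) =
  trans (cong (λ r → f (g x) + (f (h x) + r)) (Σℚ-map-concatMap g h f xs)) (sym (ℚ.+-assoc (f (g x)) _ _))

∑ : ℕ → (ℕ → ℚ) → ℚ
∑ n f = Σℚ (applyUpTo f n)

Σℚ-map-upTo : ∀ n (f : ℕ → ℚ) → Σℚ (map f (upTo n)) ≡ ∑ n f
Σℚ-map-upTo n f = cong Σℚ (map-applyUpTo id f n)

Σℚ-map-suc-upTo : ∀ n (f : ℕ → ℚ) → Σℚ (map f (map suc (upTo n))) ≡ ∑ n (f ∘ suc)
Σℚ-map-suc-upTo n f = trans (cong Σℚ (sym (map-∘ (upTo n)))) (Σℚ-map-upTo n (f ∘ suc))

∑-cong : ∀ n {f g} → (∀ i → i < n → f i ≡ g i) → ∑ n f ≡ ∑ n g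
∑-cong zero    f≡g = refl
∑-cong (suc n) f≡g = cong₂ _+_ (f≡g 0 ℕ.z<s) (∑-cong n (λ i i<n → f≡g (suc i) (ℕ.s<s i<n)))

∑-const : ∀ n c → ∑ n (λ _ → c) ≡ ℕ→ℚ n * c
∑-const zero    c = sym (ℚ.*-zeroˡ c)
∑-const (suc n) c = begin
  c + ∑ n (λ _ → c)      ≡⟨ cong (c +_) (∑-const n c) ⟩
  c + ℕ→ℚ n * c          ≡⟨ cong (_+ ℕ→ℚ n * c) (ℚ.*-identityˡ c) ⟨
  1ℚ * c + ℕ→ℚ n * c     ≡⟨ ℚ.*-distribʳ-+ c 1ℚ (ℕ→ℚ n) ⟨
  (1ℚ + ℕ→ℚ n) * c       ≡⟨ cong (_* c) (ℕ→ℚ-suc n) ⟨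
  ℕ→ℚ (suc n) * c        ∎
  where open ≡-Reasoning

∑-zero : ∀ n {f} → (∀ i → i < n → f i ≡ 0ℚ) → ∑ n f ≡ 0ℚ
∑-zero n f≡0 = trans (∑-cong n f≡0) (trans (∑-const n 0ℚ) (ℚ.*-zeroʳ (ℕ→ℚ n)))

∑-+ : ∀ n (f g : ℕ → ℚ) → ∑ n (λ i → f i + g i) ≡ ∑ n f + ∑ n g
∑-+ zero    f g = refl
∑-+ (suc n) f g = trans (cong ((f 0 + g 0) +_) (∑-+ n (f ∘ suc) (g ∘ suc))) (+-interchange (f 0) (g 0) _ _)

∑-swap : ∀ m n (f : ℕ → ℕ → ℚ) → ∑ m (λ i → ∑ n (f i)) ≡ ∑ n (λ j → ∑ m (λ i → f i j))
∑-swap zero    n f = sym (∑-zero n (λ _ _ → refl))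
∑-swap (suc m) n f = trans (cong (∑ n (f 0) +_) (∑-swap m n (f ∘ suc)))
                           (sym (∑-+ n (f 0) (λ j → ∑ m (λ i → f (suc i) j))))

∑-last : ∀ n (f : ℕ → ℚ) → ∑ (suc n) f ≡ ∑ n f + f n
∑-last zero    f = trans (ℚ.+-identityʳ (f 0)) (sym (ℚ.+-identityˡ (f 0)))
∑-last (suc n) f = trans (cong (f 0 +_) (∑-last n (f ∘ suc))) (sym (ℚ.+-assoc (f 0) _ _))

∑-reverse : ∀ n (h : ℕ → ℚ) → ∑ n (λ i → h (n ∸ i)) ≡ ∑ n (h ∘ suc)
∑-reverse zero    h = refl
∑-reverse (suc n) h = begin
  h (suc n) + ∑ n (λ i → h (n ∸ i))  ≡⟨ cong (h (suc n) +_) (∑-reverse n h) ⟩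
  h (suc n) + ∑ n (h ∘ suc)          ≡⟨ ℚ.+-comm (h (suc n)) (∑ n (h ∘ suc)) ⟩
  ∑ n (h ∘ suc) + h (suc n)          ≡⟨ ∑-last n (h ∘ suc) ⟨
  ∑ (suc n) (h ∘ suc)                ∎
  where open ≡-Reasoning

∑-shift-periodic : ∀ n (g : ℕ → ℚ) → g (suc n) ≡ g 0 → ∑ (suc n) (g ∘ suc) ≡ ∑ (suc n) g
∑-shift-periodic n g period = begin
  ∑ (suc n) (g ∘ suc)        ≡⟨ ∑-last n (g ∘ suc) ⟩
  ∑ n (g ∘ suc) + g (suc n)  ≡⟨ cong (∑ n (g ∘ suc) +_) period ⟩
  ∑ n (g ∘ suc) + g 0        ≡⟨ ℚ.+-comm _ (g 0) ⟩
  ∑ (suc n) g                ∎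
  where open ≡-Reasoning

∑-rotate : ∀ n c (f : ℕ → ℚ) → ∑ (suc n) (λ i → f ((i ℕ.+ c) % suc n)) ≡ ∑ (suc n) f
∑-rotate n zero    f = ∑-cong (suc n) (λ i i<1+n →
  cong f (trans (cong (_% suc n) (ℕ.+-identityʳ i)) (m<n⇒m%n≡m i<1+n)))
∑-rotate n (suc c) f = begin
  ∑ (suc n) (λ i → f ((i ℕ.+ suc c) % suc n))  ≡⟨ ∑-cong (suc n) (λ i _ → cong (λ j → f (j % suc n)) (ℕ.+-suc i c)) ⟩
  ∑ (suc n) (g ∘ suc)                          ≡⟨ ∑-shift-periodic n g (cong f period) ⟩
  ∑ (suc n) g                                  ≡⟨ ∑-rotate n c f ⟩
  ∑ (suc n) f                                  ∎
  where
  open ≡-Reasoning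
  g : ℕ → ℚ
  g i = f ((i ℕ.+ c) % suc n)
  period : (suc n ℕ.+ c) % suc n ≡ c % suc n
  period = trans (cong (_% suc n) (ℕ.+-comm (suc n) c)) ([m+n]%n≡m%n c (suc n))

∑-support : ∀ n (f : ℕ → ℚ) k → k < n → (∀ i → i < n → i ≢ k → f i ≡ 0ℚ) → ∑ n f ≡ f k
∑-support (suc n) f zero    _   f≡0 =
  trans (cong (f 0 +_) (∑-zero n (λ i i<n → f≡0 (suc i) (ℕ.s<s i<n) (λ ())))) (ℚ.+-identityʳ (f 0))
∑-support (suc n) f (suc k) k<n f≡0 =
  trans (cong₂ _+_ (f≡0 0 ℕ.z<s (λ ()))
                   (∑-support n (f ∘ suc) k (ℕ.s<s⁻¹ k<n) (λ i i<n i≢k → f≡0 (suc i) (ℕ.s<s i<n) (i≢k ∘ ℕ.suc-injective))))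
        (ℚ.+-identityˡ (f (suc k)))

∑-square : ∀ n a e (g : ℕ → ℚ) → ∑ n (λ i → (a * g i - e) * (a * g i - e)) ≡
           a * a * ∑ n (λ i → g i * g i) - ℕ→ℚ 2 * a * e * ∑ n g + ℕ→ℚ n * (e * e)
∑-square zero    a e g = base a e
  where
  base : ∀ a e → 0ℚ ≡ a * a * 0ℚ - ℕ→ℚ 2 * a * e * 0ℚ + ℕ→ℚ 0 * (e * e)
  base = solve-∀ ℚ-ring
∑-square (suc n) a e g = begin
  (a * g 0 - e) * (a * g 0 - e) + ∑ n (λ i → (a * g (suc i) - e) * (a * g (suc i) - e))
    ≡⟨ cong ((a * g 0 - e) * (a * g 0 - e) +_) (∑-square n a e (g ∘ suc)) ⟩
  (a * g 0 - e) * (a * g 0 - e) + (a * a * ∑ n (λ i → g (suc i) * g (suc i)) - ℕ→ℚ 2 * a * e * ∑ n (g ∘ suc) + ℕ→ℚ n * (e * e))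
    ≡⟨ step a e (g 0) _ _ (ℕ→ℚ n) ⟩
  a * a * ∑ (suc n) (λ i → g i * g i) - ℕ→ℚ 2 * a * e * ∑ (suc n) g + (1ℚ + ℕ→ℚ n) * (e * e)
    ≡⟨ cong (λ m → a * a * ∑ (suc n) (λ i → g i * g i) - ℕ→ℚ 2 * a * e * ∑ (suc n) g + m * (e * e)) (ℕ→ℚ-suc n) ⟨
  a * a * ∑ (suc n) (λ i → g i * g i) - ℕ→ℚ 2 * a * e * ∑ (suc n) g + ℕ→ℚ (suc n) * (e * e) ∎
  where
  open ≡-Reasoning
  step : ∀ a e x s₂ s₁ m → (a * x - e) * (a * x - e) + (a * a * s₂ - ℕ→ℚ 2 * a * e * s₁ + m * (e * e)) ≡
                           a * a * (x * x + s₂) - ℕ→ℚ 2 * a * e * (x + s₁) + (1ℚ + m) * (e * e)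
  step = solve-∀ ℚ-ring

ΣΣ : List A → (A → A → ℚ) → ℚ
ΣΣ xs f = Σℚ (map (λ x → Σℚ (map (λ y → f x y) xs)) xs)

ΣΣ-cong : ∀ xs {f g : A → A → ℚ} → (∀ x y → f x y ≡ g x y) → ΣΣ xs f ≡ ΣΣ xs g
ΣΣ-cong xs f≡g = cong Σℚ (map-cong (λ x → cong Σℚ (map-cong (f≡g x) xs)) xs)

ΣΣ-map : ∀ (h : A → B) (f : B → B → ℚ) xs → ΣΣ (map h xs) f ≡ ΣΣ xs (λ x y → f (h x) (h y))
ΣΣ-map h f xs = trans (cong Σℚ (sym (map-∘ xs))) (cong Σℚ (map-cong (λ x → cong Σℚ (sym (map-∘ xs))) xs))

ΣΣ-/ℕ : ∀ m .{{_ : NonZero m}} xs (f : A → A → ℚ) → ΣΣ xs (λ x y → f x y /ℕ m) ≡ ΣΣ xs f /ℕ m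
ΣΣ-/ℕ (suc m) xs f = trans (cong Σℚ (map-cong (λ x → Σℚ-map-*ʳ c (f x) xs) xs))
                           (Σℚ-map-*ʳ c (λ x → Σℚ (map (f x) xs)) xs)
  where
  c : ℚ
  c = ℤ.+ 1 ℚ./ suc m

-- Arithmetic modulo a prime

m%d≡n%d⇒d∣n∸m : ∀ m n d .{{_ : NonZero d}} → m % d ≡ n % d → d ∣ n ∸ m
m%d≡n%d⇒d∣n∸m m n d eq = divides (n / d ∸ m / d) (begin
  n ∸ m                                              ≡⟨ cong₂ _∸_ (m≡m%n+[m/n]*n n d) (m≡m%n+[m/n]*n m d) ⟩
  (n % d ℕ.+ n / d ℕ.* d) ∸ (m % d ℕ.+ m / d ℕ.* d)  ≡⟨ cong (λ r → (n % d ℕ.+ n / d ℕ.* d) ∸ (r ℕ.+ m / d ℕ.* d)) eq ⟩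
  (n % d ℕ.+ n / d ℕ.* d) ∸ (n % d ℕ.+ m / d ℕ.* d)  ≡⟨ ℕ.[m+n]∸[m+o]≡n∸o (n % d) _ _ ⟩
  n / d ℕ.* d ∸ m / d ℕ.* d                          ≡⟨ ℕ.*-distribʳ-∸ d (n / d) (m / d) ⟨
  (n / d ∸ m / d) ℕ.* d                              ∎)
  where open ≡-Reasoning

module _ {n} (isPrime : Prime (suc n)) where

  private
    p : ℕ
    p = suc n

  p∣m*k⇒k≡0 : ∀ {m k} → 0 < m → m < p → k < p → p ∣ m ℕ.* k → k ≡ 0
  p∣m*k⇒k≡0 {k = zero}      _   _   _   _    = refl
  p∣m*k⇒k≡0 {m} {k@(suc _)} 0<m m<p k<p p∣mk with euclidsLemma m k isPrime p∣mk
  ... | inj₁ p∣m = contradiction (∣⇒≤ {{ℕ.>-nonZero 0<m}} p∣m) (ℕ.<⇒≱ m<p)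
  ... | inj₂ p∣k = contradiction (∣⇒≤ p∣k) (ℕ.<⇒≱ k<p)

  m*k%p≢0 : ∀ {m k} → 0 < m → m < p → 0 < k → k < p → (m ℕ.* k) % p ≢ 0
  m*k%p≢0 {m} {k} 0<m m<p 0<k k<p mk%p≡0 =
    ℕ.<⇒≢ 0<k (sym (p∣m*k⇒k≡0 0<m m<p k<p (m%n≡0⇒n∣m (m ℕ.* k) p mk%p≡0)))

  *-cancelˡ-% : ∀ {m k k′} → 0 < m → m < p → k < p → k′ < p → (m ℕ.* k) % p ≡ (m ℕ.* k′) % p → k ≡ k′
  *-cancelˡ-% {m} 0<m m<p k<p k′<p eq = ℕ.≤-antisym (≤-of k<p (sym eq)) (≤-of k′<p eq)
    where
    ≤-of : ∀ {k k′} → k < p → (m ℕ.* k′) % p ≡ (m ℕ.* k) % p → k ℕ.≤ k′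
    ≤-of {k} {k′} k<p eq = ℕ.m∸n≡0⇒m≤n (p∣m*k⇒k≡0 0<m m<p (ℕ.≤-<-trans (ℕ.m∸n≤m k k′) k<p)
      (subst (p ∣_) (sym (ℕ.*-distribˡ-∸ m k k′)) (m%d≡n%d⇒d∣n∸m (m ℕ.* k′) (m ℕ.* k) p eq)))

  1%p≡1 : 1 % p ≡ 1
  1%p≡1 = m<n⇒m%n≡m (ℕ.nonTrivial⇒n>1 p {{prime⇒nonTrivial isPrime}})

  %-invertible : ∀ {m} → 0 < m → m < p → ∃[ y ] (m ℕ.* y) % p ≡ 1
  %-invertible {m} 0<m m<p with coprime-Bézout (prime⇒coprime isPrime {{ℕ.>-nonZero 0<m}} m<p)
  ... | Bézout.-+ x y 1+xp≡ym = y , (begin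
    (m ℕ.* y) % p        ≡⟨ cong (_% p) (trans (ℕ.*-comm m y) (sym 1+xp≡ym)) ⟩
    (1 ℕ.+ x ℕ.* p) % p  ≡⟨ [m+kn]%n≡m%n 1 x p ⟩
    1 % p                ≡⟨ 1%p≡1 ⟩
    1                    ∎)
    where open ≡-Reasoning
  -- y m ≡ −1, so (p − 1) y = n y inverts m.
  ... | Bézout.+- x y 1+ym≡xp = n ℕ.* y , (begin
    (m ℕ.* (n ℕ.* y)) % p              ≡⟨ [m+n]%n≡m%n (m ℕ.* (n ℕ.* y)) p ⟨
    (m ℕ.* (n ℕ.* y) ℕ.+ p) % p        ≡⟨ cong (_% p) (rearrange m n y) ⟩
    (1 ℕ.+ n ℕ.* (1 ℕ.+ y ℕ.* m)) % p  ≡⟨ cong (λ r → (1 ℕ.+ n ℕ.* r) % p) 1+ym≡xp ⟩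
    (1 ℕ.+ n ℕ.* (x ℕ.* p)) % p        ≡⟨ cong (λ r → (1 ℕ.+ r) % p) (ℕ.*-assoc n x p) ⟨
    (1 ℕ.+ n ℕ.* x ℕ.* p) % p          ≡⟨ [m+kn]%n≡m%n 1 (n ℕ.* x) p ⟩
    1 % p                              ≡⟨ 1%p≡1 ⟩
    1                                  ∎)
    where
    open ≡-Reasoning
    rearrange : ∀ m n y → m ℕ.* (n ℕ.* y) ℕ.+ suc n ≡ 1 ℕ.+ n ℕ.* (1 ℕ.+ y ℕ.* m)
    rearrange = ℕ-Solver.solve-∀

  %-inverse : ∀ {m} → 0 < m → m < p → ∃[ k ] 0 < k × k < p × (m ℕ.* k) % p ≡ 1
  %-inverse {m} 0<m m<p with %-invertible 0<m m<p
  ... | y , my%p≡1 = y % p , ℕ.n≢0⇒n>0 y%p≢0 , m%n<n y p , trans reduce my%p≡1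
    where
    open ≡-Reasoning
    reduce : (m ℕ.* (y % p)) % p ≡ (m ℕ.* y) % p
    reduce = begin
      (m ℕ.* (y % p)) % p          ≡⟨ %-distribˡ-* m (y % p) p ⟩
      (m % p ℕ.* (y % p % p)) % p  ≡⟨ cong (λ r → (m % p ℕ.* r) % p) (m%n%n≡m%n y p) ⟩
      (m % p ℕ.* (y % p)) % p      ≡⟨ %-distribˡ-* m y p ⟨
      (m ℕ.* y) % p                ∎
    y%p≢0 : y % p ≢ 0
    y%p≢0 y%p≡0 = ℕ.0≢1+n (begin
      0                    ≡⟨ cong (_% p) (ℕ.*-zeroʳ m) ⟨
      (m ℕ.* 0) % p        ≡⟨ cong (λ r → (m ℕ.* r) % p) y%p≡0 ⟨
      (m ℕ.* (y % p)) % p  ≡⟨ trans reduce my%p≡1 ⟩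
      1                    ∎)

-- Trace and norm in ℚ(ω)

if-≟-≡ : ∀ {x y} (a b : ℚ) → x ≡ y → (if does (x ℕ.≟ y) then a else b) ≡ a
if-≟-≡ {x} {y} a b x≡y = cong (if_then a else b) (dec-true (x ℕ.≟ y) x≡y)

if-≟-≢ : ∀ {x y} (a b : ℚ) → x ≢ y → (if does (x ℕ.≟ y) then a else b) ≡ b
if-≟-≢ {x} {y} a b x≢y = cong (if_then a else b) (dec-false (x ℕ.≟ y) x≢y)

module Trace {n} (isPrime : Prime (suc n)) where

  open Cyclo (suc n)

  private
    p : ℕ
    p = suc n
    P : ℚ
    P = ℕ→ℚ p

  summand : Elt → ℕ → ℕ → ℕ → ℚ
  summand γ x k m = if does ((m ℕ.* k) % p ℕ.≟ x) then γ m else 0ℚ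

  TrElt-∑ : ∀ γ x → TrElt γ x ≡ ∑ n (λ k → ∑ p (summand γ x (suc k)))
  TrElt-∑ γ x = trans (Σℚ-map-suc-upTo n (λ k → σ k γ x)) (∑-cong n (λ k _ → σ-∑ (suc k)))
    where
    σ-∑ : ∀ k → σ k γ x ≡ ∑ p (summand γ x k)
    σ-∑ k = trans (Σℚ-map-filterᵇ (λ m → does ((m ℕ.* k) % p ℕ.≟ x)) γ (upTo p)) (Σℚ-map-upTo p (summand γ x k))

  TrElt-0 : ∀ γ → TrElt γ 0 ≡ ℕ→ℚ n * γ 0
  TrElt-0 γ = begin
    TrElt γ 0
      ≡⟨ TrElt-∑ γ 0 ⟩
    ∑ n (λ k → ∑ p (summand γ 0 (suc k)))
      ≡⟨ ∑-cong n (λ k k<n → ∑-support p (summand γ 0 (suc k)) 0 ℕ.z<s (λ m m<p m≢0 →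
           if-≟-≢ (γ m) 0ℚ (m*k%p≢0 isPrime (ℕ.n≢0⇒n>0 m≢0) m<p ℕ.z<s (ℕ.s<s k<n)))) ⟩
    ∑ n (λ _ → γ 0)
      ≡⟨ ∑-const n (γ 0) ⟩
    ℕ→ℚ n * γ 0 ∎
    where open ≡-Reasoning

  TrElt-1 : ∀ γ → TrElt γ 1 ≡ ∑ n (γ ∘ suc)
  TrElt-1 γ = begin
    TrElt γ 1
      ≡⟨ TrElt-∑ γ 1 ⟩
    ∑ n (λ k → ∑ p (summand γ 1 (suc k)))
      ≡⟨ ∑-swap n p (λ k → summand γ 1 (suc k)) ⟩
    ∑ p (λ m → ∑ n (λ k → summand γ 1 (suc k) m))
      ≡⟨ cong₂ _+_ (∑-zero n (λ _ _ → refl)) (∑-cong n (λ m m<n → at-inverse m<n)) ⟩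
    0ℚ + ∑ n (γ ∘ suc)
      ≡⟨ ℚ.+-identityˡ _ ⟩
    ∑ n (γ ∘ suc) ∎
    where
    open ≡-Reasoning
    -- Only the inverse k of m modulo p contributes.
    at-inverse : ∀ {m} → m < n → ∑ n (λ k → summand γ 1 (suc k) (suc m)) ≡ γ (suc m)
    at-inverse {m} m<n with %-inverse isPrime ℕ.z<s (ℕ.s<s m<n)
    ... | suc k₀ , _ , ℕ.s<s k₀<n , inverse = trans
      (∑-support n (λ k → summand γ 1 (suc k) (suc m)) k₀ k₀<n (λ k k<n k≢k₀ → if-≟-≢ (γ (suc m)) 0ℚ (λ other →
        k≢k₀ (ℕ.suc-injective (*-cancelˡ-% isPrime ℕ.z<s (ℕ.s<s m<n) (ℕ.s<s k<n) (ℕ.s<s k₀<n) (trans other (sym inverse)))))))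
      (if-≟-≡ (γ (suc m)) 0ℚ inverse)

  Tr-formula : ∀ γ → Tr γ ≡ P * γ 0 - ∑ p γ
  Tr-formula γ = begin
    TrElt γ 0 - TrElt γ 1                     ≡⟨ cong₂ _-_ (TrElt-0 γ) (TrElt-1 γ) ⟩
    ℕ→ℚ n * γ 0 - ∑ n (γ ∘ suc)               ≡⟨ cong (λ m → m * γ 0 - ∑ n (γ ∘ suc)) (ℕ→ℚ-pred n) ⟩
    (P - 1ℚ) * γ 0 - ∑ n (γ ∘ suc)            ≡⟨ rearrange P (γ 0) (∑ n (γ ∘ suc)) ⟩
    P * γ 0 - (γ 0 + ∑ n (γ ∘ suc))           ∎
    where
    open ≡-Reasoning
    rearrange : ∀ P x s → (P - 1ℚ) * x - s ≡ P * x - (x + s)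
    rearrange = solve-∀ ℚ-ring

  Tr-mulω : ∀ γ {i} → i < n → Tr (mulω (suc i) γ) ≡ P * γ (n ∸ i) - ∑ p γ
  Tr-mulω γ {i} i<n = begin
    Tr (mulω (suc i) γ)
      ≡⟨ Tr-formula (mulω (suc i) γ) ⟩
    P * γ ((p ∸ suc i % p) % p) - ∑ p (λ m → γ ((m ℕ.+ (p ∸ suc i % p)) % p))
      ≡⟨ cong₂ (λ j s → P * γ j - s) offset (∑-rotate n (p ∸ suc i % p) γ) ⟩
    P * γ (n ∸ i) - ∑ p γ ∎
    where
    open ≡-Reasoning
    offset : (p ∸ suc i % p) % p ≡ n ∸ i
    offset = trans (cong (λ j → (p ∸ j) % p) (m<n⇒m%n≡m (ℕ.s<s i<n))) (m<n⇒m%n≡m (ℕ.s≤s (ℕ.m∸n≤m n i)))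

  norm²-formula : ∀ γ → γ 0 ≡ 0ℚ →
    norm² γ ≡ P * P * ∑ n (λ i → γ (suc i) * γ (suc i)) - (P + 1ℚ) * (∑ n (γ ∘ suc) * ∑ n (γ ∘ suc))
  norm²-formula γ γ0≡0 = begin
    norm² γ
      ≡⟨ Σℚ-map-suc-upTo n (λ j → Tr (mulω j γ) * Tr (mulω j γ)) ⟩
    ∑ n (λ j → Tr (mulω (suc j) γ) * Tr (mulω (suc j) γ))
      ≡⟨ ∑-cong n (λ j j<n → cong₂ _*_ (Tr-mulω γ j<n) (Tr-mulω γ j<n)) ⟩
    ∑ n (λ j → square (n ∸ j))
      ≡⟨ ∑-reverse n square ⟩
    ∑ n (square ∘ suc)
      ≡⟨ ∑-square n P (∑ p γ) (γ ∘ suc) ⟩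
    P * P * ∑₂ - ℕ→ℚ 2 * P * ∑ p γ * S + ℕ→ℚ n * (∑ p γ * ∑ p γ)
      ≡⟨ cong₂ (λ t m → P * P * ∑₂ - ℕ→ℚ 2 * P * t * S + m * (t * t)) ∑pγ≡S (ℕ→ℚ-pred n) ⟩
    P * P * ∑₂ - ℕ→ℚ 2 * P * S * S + (P - 1ℚ) * (S * S)
      ≡⟨ simplify P ∑₂ S ⟩
    P * P * ∑₂ - (P + 1ℚ) * (S * S) ∎
    where
    open ≡-Reasoning
    square : ℕ → ℚ
    square i = (P * γ i - ∑ p γ) * (P * γ i - ∑ p γ)
    S ∑₂ : ℚ
    S  = ∑ n (γ ∘ suc)
    ∑₂ = ∑ n (λ i → γ (suc i) * γ (suc i))
    ∑pγ≡S : ∑ p γ ≡ S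
    ∑pγ≡S = trans (cong (_+ S) γ0≡0) (ℚ.+-identityˡ S)
    simplify : ∀ P q s → P * P * q - ℕ→ℚ 2 * P * s * s + (P - 1ℚ) * (s * s) ≡ P * P * q - (P + 1ℚ) * (s * s)
    simplify = solve-∀ ℚ-ring

-- Sums over pairs of sign vectors

ΣΣ-allSigns-suc : ∀ n (f : List Bool → List Bool → ℚ) →
  ΣΣ (allSigns (suc n)) f ≡
  ΣΣ (allSigns n) (λ s t → (f (true ∷ s) (true ∷ t) + f (true ∷ s) (false ∷ t))
                         + (f (false ∷ s) (true ∷ t) + f (false ∷ s) (false ∷ t)))
ΣΣ-allSigns-suc n f = begin
  ΣΣ (allSigns (suc n)) f
    ≡⟨ Σℚ-map-concatMap (true ∷_) (false ∷_) (λ s → Σℚ (map (f s) (allSigns (suc n)))) (allSigns n) ⟩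
  Σℚ (map (λ s → Σℚ (map (f (true ∷ s)) (allSigns (suc n))) + Σℚ (map (f (false ∷ s)) (allSigns (suc n)))) (allSigns n))
    ≡⟨ cong Σℚ (map-cong (λ s → cong₂ _+_ (sum-over-t (true ∷ s)) (sum-over-t (false ∷ s))) (allSigns n)) ⟩
  Σℚ (map (λ s → Σℚ (map (λ t → f (true ∷ s) (true ∷ t) + f (true ∷ s) (false ∷ t)) (allSigns n))
               + Σℚ (map (λ t → f (false ∷ s) (true ∷ t) + f (false ∷ s) (false ∷ t)) (allSigns n))) (allSigns n))
    ≡⟨ cong Σℚ (map-cong (λ s → sym (Σℚ-map-+ _ _ (allSigns n))) (allSigns n)) ⟩
  ΣΣ (allSigns n) (λ s t → (f (true ∷ s) (true ∷ t) + f (true ∷ s) (false ∷ t))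
                         + (f (false ∷ s) (true ∷ t) + f (false ∷ s) (false ∷ t))) ∎
  where
  open ≡-Reasoning
  sum-over-t : ∀ s → Σℚ (map (f s) (allSigns (suc n))) ≡ Σℚ (map (λ t → f s (true ∷ t) + f s (false ∷ t)) (allSigns n))
  sum-over-t s = Σℚ-map-concatMap (true ∷_) (false ∷_) (f s) (allSigns n)

length-allSigns² : ∀ n → length (allSigns n) ℕ.* length (allSigns n) ≡ 4 ℕ.^ n
length-allSigns² zero    = refl
length-allSigns² (suc n) = begin
  length (allSigns (suc n)) ℕ.* length (allSigns (suc n))  ≡⟨ cong (λ l → l ℕ.* l) (length-doubles (allSigns n)) ⟩
  2 ℕ.* ℓ ℕ.* (2 ℕ.* ℓ)                                    ≡⟨ regroup ℓ ⟩
  4 ℕ.* (ℓ ℕ.* ℓ)                                          ≡⟨ cong (4 ℕ.*_) (length-allSigns² n) ⟩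
  4 ℕ.* 4 ℕ.^ n                                            ∎
  where
  open ≡-Reasoning
  ℓ : ℕ
  ℓ = length (allSigns n)
  length-doubles : ∀ (xs : List (List Bool)) → length (concatMap (λ s → (true ∷ s) ∷ (false ∷ s) ∷ []) xs) ≡ 2 ℕ.* length xs
  length-doubles []       = refl
  length-doubles (x ∷ xs) = trans (cong (2 ℕ.+_) (length-doubles xs)) (sym (ℕ.*-suc 2 (length xs)))
  regroup : ∀ ℓ → 2 ℕ.* ℓ ℕ.* (2 ℕ.* ℓ) ≡ 4 ℕ.* (ℓ ℕ.* ℓ)
  regroup = ℕ-Solver.solve-∀

-- F evaluated after prepending the sign pairs (+,+), (+,−), (−,+), (−,−) to (s, t); they shift (Q, D)
-- by (x², x) with x = 0, −2v, 2v, 0, written as differences of entries ±v. INLINE makes fourPoint and the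
-- polynomials below transparent to solve-∀, which treats any other defined function as an opaque constant.
fourPoint : (ℚ → ℚ → ℚ) → ℚ → ℚ → ℚ → ℚ
fourPoint F v q d =
    (F ((v - v) * (v - v) + q) ((v - v) + d) + F ((- v - v) * (- v - v) + q) ((- v - v) + d))
  + (F ((v - - v) * (v - - v) + q) ((v - - v) + d) + F ((- v - - v) * (- v - - v) + q) ((- v - - v) + d))
{-# INLINE fourPoint #-}

quartic : (a b c e f g : ℚ) → ℚ → ℚ → ℚ
quartic a b c e f g q d = a * (q * q) + b * (q * (d * d)) + c * (d * d * (d * d)) + e * q + f * (d * d) + g
{-# INLINE quartic #-}

quartic-mean : ℚ → ℚ → (a b c e f g : ℚ) → ℚ
quartic-mean v m a b c e f g =
  (a + b) * (ℕ→ℚ 4 * m * (m + 1ℚ)) * (v * v * (v * v)) + c * (ℕ→ℚ 4 * m * (ℕ→ℚ 3 * m - 1ℚ)) * (v * v * (v * v))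
  + (e + f) * (ℕ→ℚ 2 * m) * (v * v) + g
{-# INLINE quartic-mean #-}

fourPoint-quartic : ∀ a b c e f g v q d → fourPoint (quartic a b c e f g) v q d ≡
  quartic (ℕ→ℚ 4 * a) (ℕ→ℚ 4 * b) (ℕ→ℚ 4 * c)
          (ℕ→ℚ 4 * e + ℕ→ℚ 8 * (v * v) * (ℕ→ℚ 2 * a + b))
          (ℕ→ℚ 4 * f + ℕ→ℚ 8 * (v * v) * (b + ℕ→ℚ 6 * c))
          (ℕ→ℚ 4 * g + ℕ→ℚ 8 * (v * v) * (e + f) + ℕ→ℚ 32 * (v * v * (v * v)) * (a + b + c)) q d
fourPoint-quartic = solve-∀ ℚ-ring

quartic-mean-suc : ∀ a b c e f g v m w →
  w * quartic-mean v m (ℕ→ℚ 4 * a) (ℕ→ℚ 4 * b) (ℕ→ℚ 4 * c)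
          (ℕ→ℚ 4 * e + ℕ→ℚ 8 * (v * v) * (ℕ→ℚ 2 * a + b))
          (ℕ→ℚ 4 * f + ℕ→ℚ 8 * (v * v) * (b + ℕ→ℚ 6 * c))
          (ℕ→ℚ 4 * g + ℕ→ℚ 8 * (v * v) * (e + f) + ℕ→ℚ 32 * (v * v * (v * v)) * (a + b + c))
  ≡ ℕ→ℚ 4 * w * quartic-mean v (1ℚ + m) a b c e f g
quartic-mean-suc = solve-∀ ℚ-ring

module _ (N : ℕ) where

  -- δ s t i is the coefficient of ω^(i+1) in toElt N t − toElt N s.
  δ : List Bool → List Bool → ℕ → ℚ
  δ s t i = signCoeff N t i - signCoeff N s i

  Q D : ℕ → List Bool → List Bool → ℚ
  Q n s t = ∑ n (λ i → δ s t i * δ s t i)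
  D n s t = ∑ n (δ s t)

  ΣΣ-allSigns-quartic : ∀ n a b c e f g →
    ΣΣ (allSigns n) (λ s t → quartic a b c e f g (Q n s t) (D n s t)) ≡
    ℕ→ℚ (4 ℕ.^ n) * quartic-mean (ℕ→ℚ N) (ℕ→ℚ n) a b c e f g
  ΣΣ-allSigns-quartic zero    a b c e f g = base a b c e f g (ℕ→ℚ N)
    where
    base : ∀ a b c e f g v → quartic a b c e f g 0ℚ 0ℚ + 0ℚ + 0ℚ ≡ ℕ→ℚ 1 * quartic-mean v (ℕ→ℚ 0) a b c e f g
    base = solve-∀ ℚ-ring
  ΣΣ-allSigns-quartic (suc n) a b c e f g = begin
    ΣΣ (allSigns (suc n)) (λ s t → quartic a b c e f g (Q (suc n) s t) (D (suc n) s t))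
      ≡⟨ ΣΣ-allSigns-suc n (λ s t → quartic a b c e f g (Q (suc n) s t) (D (suc n) s t)) ⟩
    ΣΣ (allSigns n) (λ s t → fourPoint (quartic a b c e f g) v (Q n s t) (D n s t))
      ≡⟨ ΣΣ-cong (allSigns n) (λ s t → fourPoint-quartic a b c e f g v (Q n s t) (D n s t)) ⟩
    ΣΣ (allSigns n) (λ s t → quartic a′ b′ c′ e′ f′ g′ (Q n s t) (D n s t))
      ≡⟨ ΣΣ-allSigns-quartic n a′ b′ c′ e′ f′ g′ ⟩
    ℕ→ℚ (4 ℕ.^ n) * quartic-mean v (ℕ→ℚ n) a′ b′ c′ e′ f′ g′
      ≡⟨ quartic-mean-suc a b c e f g v (ℕ→ℚ n) (ℕ→ℚ (4 ℕ.^ n)) ⟩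
    ℕ→ℚ 4 * ℕ→ℚ (4 ℕ.^ n) * quartic-mean v (1ℚ + ℕ→ℚ n) a b c e f g
      ≡⟨ cong₂ (λ w m → w * quartic-mean v m a b c e f g) (ℕ→ℚ-* 4 (4 ℕ.^ n)) (ℕ→ℚ-suc n) ⟨
    ℕ→ℚ (4 ℕ.^ suc n) * quartic-mean v (ℕ→ℚ (suc n)) a b c e f g ∎
    where
    open ≡-Reasoning
    v a′ b′ c′ e′ f′ g′ : ℚ
    v  = ℕ→ℚ N
    a′ = ℕ→ℚ 4 * a
    b′ = ℕ→ℚ 4 * b
    c′ = ℕ→ℚ 4 * c
    e′ = ℕ→ℚ 4 * e + ℕ→ℚ 8 * (v * v) * (ℕ→ℚ 2 * a + b)
    f′ = ℕ→ℚ 4 * f + ℕ→ℚ 8 * (v * v) * (b + ℕ→ℚ 6 * c)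
    g′ = ℕ→ℚ 4 * g + ℕ→ℚ 8 * (v * v) * (e + f) + ℕ→ℚ 32 * (v * v * (v * v)) * (a + b + c)

normQuartic : ℚ → ℚ → ℚ → ℚ
normQuartic P q d = quartic (P * P * (P * P)) (- (ℕ→ℚ 2 * (P * P) * (P + 1ℚ))) ((P + 1ℚ) * (P + 1ℚ)) 0ℚ 0ℚ 0ℚ q d
{-# INLINE normQuartic #-}

rhs-numerator : ℚ → ℚ
rhs-numerator P = P * P * P * P * P - ℕ→ℚ 2 * (P * P * P * P) + P * P * P + ℕ→ℚ 2 * (P * P) - ℕ→ℚ 5 * P - ℕ→ℚ 4
{-# INLINE rhs-numerator #-}

𝔡⁴-toElt : ∀ {n} → Prime (suc n) → ∀ N s t →
  Cyclo.𝔡⁴ (suc n) N (toElt N s) (toElt N t) ≡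
  normQuartic (ℕ→ℚ (suc n)) (Q N n s t) (D N n s t) /ℕ (((2 ℕ.* N ℕ.* suc n) ℕ.^ 4) ℕ.* (n ℕ.^ 2))
𝔡⁴-toElt {n} isPrime N s t = cong (_/ℕ (((2 ℕ.* N ℕ.* suc n) ℕ.^ 4) ℕ.* (n ℕ.^ 2)))
  (trans (cong (λ x → x * x) (Trace.norm²-formula isPrime (Cyclo.sub (suc n) (toElt N t) (toElt N s)) refl))
         (square (ℕ→ℚ (suc n)) (Q N n s t) (D N n s t)))
  where
  square : ∀ P q d → (P * P * q - (P + 1ℚ) * (d * d)) * (P * P * q - (P + 1ℚ) * (d * d)) ≡ normQuartic P q d
  square = solve-∀ ℚ-ring

ℕ→ℚ-𝔡⁴-denominator : ∀ N n → let P = ℕ→ℚ (suc n) in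
  ℕ→ℚ (((2 ℕ.* N ℕ.* suc n) ℕ.^ 4) ℕ.* (n ℕ.^ 2)) ≡ (ℕ→ℚ 2 * ℕ→ℚ N * P) ^ℚ 4 * (P - 1ℚ) ^ℚ 2
ℕ→ℚ-𝔡⁴-denominator N n = trans (ℕ→ℚ-* ((2 ℕ.* N ℕ.* suc n) ℕ.^ 4) (n ℕ.^ 2)) (cong₂ _*_
  (trans (ℕ→ℚ-^ (2 ℕ.* N ℕ.* suc n) 4) (cong (_^ℚ 4) (trans (ℕ→ℚ-* (2 ℕ.* N) (suc n)) (cong (_* ℕ→ℚ (suc n)) (ℕ→ℚ-* 2 N)))))
  (trans (ℕ→ℚ-^ n 2) (cong (_^ℚ 2) (ℕ→ℚ-pred n))))

quartic-mean-normQuartic : ∀ P v →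
  quartic-mean v (P - 1ℚ) (P * P * (P * P)) (- (ℕ→ℚ 2 * (P * P) * (P + 1ℚ))) ((P + 1ℚ) * (P + 1ℚ)) 0ℚ 0ℚ 0ℚ ≡
  ℕ→ℚ 4 * (P - 1ℚ) * (v * v * (v * v)) * rhs-numerator P
quartic-mean-normQuartic = solve-∀ ℚ-ring

clear-denominators : ∀ P a b c d → a * P ≡ 1ℚ → b * P ^ℚ 2 ≡ ℕ→ℚ 2 → c * P ^ℚ 3 ≡ ℕ→ℚ 5 → d * P ^ℚ 4 ≡ ℕ→ℚ 4 →
                (P - ℕ→ℚ 2 + a + b - c - d) * P ^ℚ 4 ≡ rhs-numerator P
clear-denominators P a b c d aP bP² cP³ dP⁴ = trans (expand P a b c d) (substitute aP bP² cP³ dP⁴)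
  where
  expand : ∀ P a b c d → (P - ℕ→ℚ 2 + a + b - c - d) * (P * (P * (P * (P * 1ℚ)))) ≡
    P * (P * (P * (P * (P * 1ℚ)))) - ℕ→ℚ 2 * (P * (P * (P * (P * 1ℚ)))) + (a * P) * (P * (P * (P * 1ℚ)))
      + (b * (P * (P * 1ℚ))) * (P * (P * 1ℚ)) - (c * (P * (P * (P * 1ℚ)))) * P - d * (P * (P * (P * (P * 1ℚ))))
  expand = solve-∀ ℚ-ring
  tidy : ∀ P → P * (P * (P * (P * (P * 1ℚ)))) - ℕ→ℚ 2 * (P * (P * (P * (P * 1ℚ)))) + 1ℚ * (P * (P * (P * 1ℚ)))
                 + ℕ→ℚ 2 * (P * (P * 1ℚ)) - ℕ→ℚ 5 * P - ℕ→ℚ 4 ≡ rhs-numerator P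
  tidy = solve-∀ ℚ-ring
  substitute : ∀ {x y z w} → x ≡ 1ℚ → y ≡ ℕ→ℚ 2 → z ≡ ℕ→ℚ 5 → w ≡ ℕ→ℚ 4 →
               P ^ℚ 5 - ℕ→ℚ 2 * P ^ℚ 4 + x * P ^ℚ 3 + y * P ^ℚ 2 - z * P - w ≡ rhs-numerator P
  substitute refl refl refl refl = tidy P

rhs-cleared : ∀ n → let p = suc (suc n); P = ℕ→ℚ p in
              rhs p * (ℕ→ℚ 4 * (P - 1ℚ)) * P ^ℚ 4 ≡ rhs-numerator P
rhs-cleared n = begin
  rhs p * (ℕ→ℚ 4 * (P - 1ℚ)) * P ^ℚ 4  ≡⟨ cong (λ x → rhs p * x * P ^ℚ 4) 4[p-1] ⟨
  rhs p * ℕ→ℚ (4 ℕ.* suc n) * P ^ℚ 4   ≡⟨ cong (_* P ^ℚ 4) (/ℕ-*-ℕ→ℚ (P - ℕ→ℚ 2 + a + b - c - d) (4 ℕ.* suc n)) ⟩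
  (P - ℕ→ℚ 2 + a + b - c - d) * P ^ℚ 4  ≡⟨ clear-denominators P a b c d (/ℕ-*-ℕ→ℚ 1ℚ p) (cancel (ℕ→ℚ 2) 2) (cancel (ℕ→ℚ 5) 3) (cancel (ℕ→ℚ 4) 4) ⟩
  rhs-numerator P                      ∎
  where
  open ≡-Reasoning
  p : ℕ
  p = suc (suc n)
  P a b c d : ℚ
  P = ℕ→ℚ p
  a = 1ℚ /ℕ p
  b = ℕ→ℚ 2 /ℕ (p ℕ.^ 2)
  c = ℕ→ℚ 5 /ℕ (p ℕ.^ 3)
  d = ℕ→ℚ 4 /ℕ (p ℕ.^ 4)
  4[p-1] : ℕ→ℚ (4 ℕ.* suc n) ≡ ℕ→ℚ 4 * (P - 1ℚ)
  4[p-1] = trans (ℕ→ℚ-* 4 (suc n)) (cong (ℕ→ℚ 4 *_) (ℕ→ℚ-pred (suc n)))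
  cancel : ∀ c k → (c /ℕ (p ℕ.^ k)) * P ^ℚ k ≡ c
  cancel c k = trans (cong ((c /ℕ (p ℕ.^ k)) *_) (sym (ℕ→ℚ-^ p k))) (/ℕ-*-ℕ→ℚ c (p ℕ.^ k) {{ℕ.m^n≢0 p k}})

ΣΣ-allSigns-normQuartic : ∀ n N → let m = suc n; p = suc m; P = ℕ→ℚ p in
  ΣΣ (allSigns m) (λ s t → normQuartic P (Q N m s t) (D N m s t)) ≡
  rhs p * ℕ→ℚ (4 ℕ.^ m) * ℕ→ℚ (((2 ℕ.* N ℕ.* p) ℕ.^ 4) ℕ.* (m ℕ.^ 2))
ΣΣ-allSigns-normQuartic n N = begin
  ΣΣ (allSigns m) (λ s t → normQuartic P (Q N m s t) (D N m s t))
    ≡⟨ ΣΣ-allSigns-quartic N m a b c 0ℚ 0ℚ 0ℚ ⟩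
  w * quartic-mean v (ℕ→ℚ m) a b c 0ℚ 0ℚ 0ℚ
    ≡⟨ cong (λ x → w * quartic-mean v x a b c 0ℚ 0ℚ 0ℚ) (ℕ→ℚ-pred m) ⟩
  w * quartic-mean v (P - 1ℚ) a b c 0ℚ 0ℚ 0ℚ
    ≡⟨ cong (w *_) (quartic-mean-normQuartic P v) ⟩
  w * (ℕ→ℚ 4 * (P - 1ℚ) * (v * v * (v * v)) * rhs-numerator P)
    ≡⟨ cong (λ x → w * (ℕ→ℚ 4 * (P - 1ℚ) * (v * v * (v * v)) * x)) (rhs-cleared n) ⟨
  w * (ℕ→ℚ 4 * (P - 1ℚ) * (v * v * (v * v)) * (rhs p * (ℕ→ℚ 4 * (P - 1ℚ)) * P ^ℚ 4))
    ≡⟨ regroup w (rhs p) P v ⟩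
  rhs p * w * ((ℕ→ℚ 2 * v * P) ^ℚ 4 * (P - 1ℚ) ^ℚ 2)
    ≡⟨ cong (rhs p * w *_) (ℕ→ℚ-𝔡⁴-denominator N m) ⟨
  rhs p * w * ℕ→ℚ (((2 ℕ.* N ℕ.* p) ℕ.^ 4) ℕ.* (m ℕ.^ 2)) ∎
  where
  open ≡-Reasoning
  m p : ℕ
  m = suc n
  p = suc m
  P v w a b c : ℚ
  P = ℕ→ℚ p
  v = ℕ→ℚ N
  w = ℕ→ℚ (4 ℕ.^ m)
  a = P * P * (P * P)
  b = - (ℕ→ℚ 2 * (P * P) * (P + 1ℚ))
  c = (P + 1ℚ) * (P + 1ℚ)
  regroup : ∀ w r P v → w * (ℕ→ℚ 4 * (P - 1ℚ) * (v * v * (v * v)) * (r * (ℕ→ℚ 4 * (P - 1ℚ)) * (P * (P * (P * (P * 1ℚ))))))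
    ≡ r * w * ((ℕ→ℚ 2 * v * P) * ((ℕ→ℚ 2 * v * P) * ((ℕ→ℚ 2 * v * P) * ((ℕ→ℚ 2 * v * P) * 1ℚ))) * ((P - 1ℚ) * ((P - 1ℚ) * 1ℚ)))
  regroup = solve-∀ ℚ-ring

lemma6 : (p : ℕ) .{{_ : NonZero p}} → Prime p → p ≢ 2 →
         (N : ℕ) → N ≥ 1 →
         average𝔡⁴ p N ≡ rhs p
lemma6 (suc zero)    isPrime = contradiction refl (ℕ.nonTrivial⇒≢1 {{prime⇒nonTrivial isPrime}})
lemma6 (suc (suc n)) isPrime _ (suc N) _ = begin
  average𝔡⁴ p (suc N)
    ≡⟨ cong₂ _/ℕ_ (ΣΣ-map (toElt (suc N)) (Cyclo.𝔡⁴ p (suc N)) (allSigns m)) #𝒱² ⟩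
  ΣΣ (allSigns m) (λ s t → Cyclo.𝔡⁴ p (suc N) (toElt (suc N) s) (toElt (suc N) t)) /ℕ (4 ℕ.^ m)
    ≡⟨ cong (_/ℕ (4 ℕ.^ m)) (trans (ΣΣ-cong (allSigns m) (𝔡⁴-toElt isPrime (suc N))) (ΣΣ-/ℕ K (allSigns m) _)) ⟩
  (ΣΣ (allSigns m) (λ s t → normQuartic P (Q (suc N) m s t) (D (suc N) m s t)) /ℕ K) /ℕ (4 ℕ.^ m)
    ≡⟨ /ℕ-unique (4 ℕ.^ m) {{ℕ.m^n≢0 4 m}} (/ℕ-unique K (ΣΣ-allSigns-normQuartic n (suc N))) ⟩
  rhs p ∎
  where
  open ≡-Reasoning
  m p K : ℕ
  m = suc n
  p = suc m
  K = ((2 ℕ.* suc N ℕ.* p) ℕ.^ 4) ℕ.* (m ℕ.^ 2)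
  P : ℚ
  P = ℕ→ℚ p
  #𝒱² : length (𝒱 p (suc N)) ℕ.* length (𝒱 p (suc N)) ≡ 4 ℕ.^ m
  #𝒱² = trans (cong (λ l → l ℕ.* l) (length-map (toElt (suc N)) (allSigns m))) (length-allSigns² m)
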